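{- Writing $f|_{q^s}$ for the coefficient of $q^s$ in a polynomial $f$: (1) For all $n\ge k\ge1$, $\overline{\mathbf{SF}}_{n,k}(q)|_{q^0}=\binom{n-1}{k-1}$. (2) For all $n>k\ge2$, $\overline{\mathbf{SF}}_{n,k}(q)|_{q}=(k-2)\binom{n-1}{k}$. (3) For all integers $s\ge0$ and $n\ge s$, $\overline{\mathbf{SF}}_{n,3}(q)|_{q^s}=\binom{n-1}{s+2}$. (4) For all $n\ge k\ge3$, $\overline{\mathbf{SF}}_{n,k}(q)|_{q^2}=(k-3)\binom{n-1}{k}+\binom{k-1}{2}\binom{n-1}{k+1}$. (5) For all $n\ge k\ge4$, $\overline{\mathbf{SF}}_{n,k}(q)|_{q^3}=(k-4)\binom{n-1}{k}+\left(\binom{k-1}{2}+\binom{k-2}{2}-1\right)\binom{n-1}{k+1}+\binom{k}{3}\binom{n-1}{k+2}$. (6) For all $n\ge k\ge4$, $$\overline{\mathbf{SF}}_{n,k}(q)|_{q^4}=(k-4)\binom{n-1}{k}+\left(\binom{k-1}{2}+\binom{k-2}{2}+\binom{k-3}{2}-3\right)\binom{n-1}{k+1}+\left(2\binom{k}{3}+\binom{k-1}{3}-k+1\right)\binom{n-1}{k+2}+\binom{k+1}{4}\binom{n-1}{k+3}.$$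
   Context: Fibonacci numbers: $F_0=0$, $F_1=1$, $F_m=F_{m-1}+F_{m-2}$. For any integer $m$, $[m]_q=\frac{1-q^m}{1-q}$. For $k\ge0$ let $\overline{[x]}_{\downarrow_{q,F,k}}=\prod_{i=0}^{k-1}([x]_q-[F_i]_q)$ (empty product $=1$). For $n\ge0$, $\overline{\mathbf{SF}}_{n,k}(q)$ ($0\le k\le n$) are the unique functions of $q$ (they are polynomials in $q$) with $[x]_q^n=\sum_{k=0}^n\overline{\mathbf{SF}}_{n,k}(q)\overline{[x]}_{\downarrow_{q,F,k}}$ for all positive integers $x$; $\overline{\mathbf{SF}}_{n,k}(q)=0$ if $k>n$. Binomial convention: $\binom{m}{j}=0$ whenever $m<j$ (including $m<0$). -}

module Defs where

open import Data.Nat as ℕ using (ℕ; zero; suc; _<ᵇ_; _∸_)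
open import Data.Nat.Combinatorics using (_C_)
open import Data.Integer using (ℤ; +_; _+_; _*_; _-_)
open import Data.Bool using (if_then_else_)
open import Data.Product using (_×_)
open import Relation.Binary.PropositionalEquality using (_≡_)

-- Formal power series in q with integer coefficients, as coefficient
-- sequences: f s = coefficient of q^s.  Polynomials are the finitely
-- supported ones; an identity of polynomials is a pointwise identity
-- of their coefficient sequences.
Series : Set
Series = ℕ → ℤ

sumTo : ℕ → (ℕ → ℤ) → ℤ
sumTo zero    f = f zero
sumTo (suc n) f = sumTo n f + f (suc n)

sumSer : ℕ → (ℕ → Series) → Series
sumSer n f s = sumTo n (λ i → f i s)

0S : Series
0S _ = + 0

1S : Series
1S zero    = + 1
1S (suc _) = + 0

_⊕_ : Series → Series → Series
(f ⊕ g) s = f s + g s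

_⊖_ : Series → Series → Series
(f ⊖ g) s = f s - g s

_⊛_ : Series → Series → Series
(f ⊛ g) s = sumTo s (λ i → f i * g (s ∸ i))

infixl 7 _⊛_
infixl 6 _⊕_ _⊖_

_^S_ : Series → ℕ → Series
f ^S zero  = 1S
f ^S suc n = f ⊛ (f ^S n)

-- [m]_q = 1 + q + ... + q^{m-1}  for m ≥ 0
qint : ℕ → Series
qint m s = if s <ᵇ m then + 1 else + 0

fib : ℕ → ℕ
fib zero          = 0
fib (suc zero)    = 1
fib (suc (suc m)) = fib (suc m) ℕ.+ fib m

fibFall : ℕ → ℕ → Series
fibFall x zero    = 1S
fibFall x (suc k) = fibFall x k ⊛ (qint x ⊖ qint (fib k))

-- binom(n-1, j) with the convention binom(m, j) = 0 for m < 0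
binomPred : ℕ → ℕ → ℤ
binomPred zero    j = + 0
binomPred (suc m) j = + (m C j)

bin : ℕ → ℕ → ℤ
bin m j = + (m C j)

IsSF : (ℕ → ℕ → Series) → Set
IsSF SF =
  ((n k : ℕ) → n ℕ.< k → (s : ℕ) → SF n k s ≡ + 0) ×
  ((n x : ℕ) → 1 ℕ.≤ x → (s : ℕ) →
     (qint x ^S n) s ≡ sumSer n (λ k → SF n k ⊛ fibFall x k) s)

-- Multiplying the expansion of [x]ⁿ by [x] and using
--   [x]·Π_{i<k}([x] − [F_i]) = Π_{i≤k}([x] − [F_i]) + [F_k]·Π_{i<k}([x] − [F_i])
-- gives the recurrence SF(n+1,k) = SF(n,k−1) + [F_k]_q·SF(n,k), because coefficients in a Newton basis are
-- unique: over a commutative ring, a polynomial of degree ≤ N vanishing at N+1 points whose pairwise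
-- differences are non-zero-divisors is zero, and [j]_q − [i]_q = q^i(1 + q + ⋯) is a non-zero-divisor among
-- power series. As [F_k]_q = 1 + q + ⋯ + q^{F_k − 1}, the coefficient of q^s in [F_k]_q·f is f_0 + ⋯ + f_s as
-- soon as F_k > s, so each formula follows by induction on n from Pascal's rule (the columns k ≤ 4, where
-- F_k ≤ s can happen, are treated separately). Both sides vanish for n < k.

module Submission where

open import Algebra.Bundles using (CommutativeRing)
open import Data.Nat using (ℕ; zero; suc; _∸_; _<_; _≤_; z≤n; s≤s)
import Data.Nat as ℕ
import Data.Nat.Properties as ℕₚ
open import Data.Product using (_×_; _,_; proj₁; proj₂)
open import Function using (_∘_)
open import Level using (_⊔_)

module NewtonInterpolation {c ℓ} (R : CommutativeRing c ℓ) where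

  open CommutativeRing R hiding (zero)
  open import Algebra.Properties.Ring ring using (-‿distribˡ-*; -0#≈0#)
  open import Algebra.Properties.AbelianGroup +-abelianGroup using (⁻¹-anti-homo‿-; ⁻¹-∙-comm)
  open import Algebra.Properties.Group +-group using (x∙y⁻¹≈ε⇒x≈y)
  open import Algebra.Solver.Ring.NaturalCoefficients.Default commutativeSemiring
    using (solve; _:=_; _:+_; _:*_)
  open import Relation.Binary.Reasoning.Setoid setoid
  open import Data.Vec using (Vec; []; _∷_)
  open import Data.Vec.Relation.Unary.All using (All; []; _∷_)

  IsRegular : Carrier → Set (c ⊔ ℓ)
  IsRegular z = ∀ r → z * r ≈ 0# → r ≈ 0#

  horner : ∀ {n} → Vec Carrier n → Carrier → Carrier
  horner []       y = 0#
  horner (p ∷ ps) y = p + y * horner ps y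

  mulLinear : ∀ {n} → Carrier → Carrier → Vec Carrier n → Vec Carrier (suc n)
  mulLinear b c []       = c ∷ []
  mulLinear b c (p ∷ ps) = (c - b * p) ∷ mulLinear b p ps

  horner-mulLinear : ∀ {n} b c (ps : Vec Carrier n) y →
                     horner (mulLinear b c ps) y ≈ c + (y - b) * horner ps y
  horner-mulLinear b c [] y = trans (+-congˡ (zeroʳ y)) (sym (+-congˡ (zeroʳ (y - b))))
  horner-mulLinear b c (p ∷ ps) y = begin
    (c - b * p) + y * horner (mulLinear b p ps) y   ≈⟨ +-congˡ (*-congˡ (horner-mulLinear b p ps y)) ⟩
    (c - b * p) + y * (p + (y - b) * horner ps y)   ≈⟨ +-congʳ (+-congˡ (-‿distribˡ-* b p)) ⟩
    (c + (- b) * p) + y * (p + (y - b) * horner ps y)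
      ≈⟨ solve 5 (λ c nb p y H → (c :+ nb :* p) :+ y :* (p :+ (y :+ nb) :* H)
                                  := c :+ (y :+ nb) :* (p :+ y :* H))
               refl c (- b) p y (horner ps y) ⟩
    c + (y - b) * (p + y * horner ps y)             ∎

  mulLinear-allZero : ∀ {n} b c (ps : Vec Carrier n) →
                      All (_≈ 0#) (mulLinear b c ps) → c ≈ 0# × All (_≈ 0#) ps
  mulLinear-allZero b c []       (c≈0 ∷ []) = c≈0 , []
  mulLinear-allZero b c (p ∷ ps) (c-bp≈0 ∷ rest) with mulLinear-allZero b p ps rest
  ... | p≈0 , ps≈0 = c≈0 , p≈0 ∷ ps≈0
    where
    c≈0 : c ≈ 0#
    c≈0 = begin
      c                   ≈⟨ sym (trans (+-assoc _ _ _) (trans (+-congˡ (-‿inverseˡ _)) (+-identityʳ c))) ⟩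
      (c - b * p) + b * p ≈⟨ +-cong c-bp≈0 (*-congˡ p≈0) ⟩
      0# + b * 0#         ≈⟨ trans (+-identityˡ _) (zeroʳ b) ⟩
      0#                  ∎

  divByRoot : ∀ {n} → Carrier → Vec Carrier (suc n) → Vec Carrier n
  divByRoot r (p ∷ [])     = []
  divByRoot r (p ∷ q ∷ ps) = horner (q ∷ ps) r ∷ divByRoot r (q ∷ ps)

  horner-divByRoot : ∀ {n} r (ps : Vec Carrier (suc n)) y →
                     horner ps y ≈ horner ps r + (y - r) * horner (divByRoot r ps) y
  horner-divByRoot r (p ∷ []) y =
    trans (+-congˡ (zeroʳ y))
          (sym (trans (+-congʳ (+-congˡ (zeroʳ r))) (trans (+-congˡ (zeroʳ (y - r))) (+-identityʳ _))))
  horner-divByRoot r (p ∷ q ∷ ps) y = begin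
    p + y * H y                                          ≈⟨ +-congˡ (*-congˡ (horner-divByRoot r (q ∷ ps) y)) ⟩
    p + y * (H r + (y - r) * Q)
      ≈⟨ sym (trans (+-congˡ (trans (*-congʳ (-‿inverseʳ r)) (zeroˡ _))) (+-identityʳ _)) ⟩
    p + y * (H r + (y - r) * Q) + (r - r) * H r
      ≈⟨ solve 6 (λ p y r nr E Q → p :+ y :* (E :+ (y :+ nr) :* Q) :+ (r :+ nr) :* E
                                   := (p :+ r :* E) :+ (y :+ nr) :* (E :+ y :* Q))
               refl p y r (- r) (H r) Q ⟩
    (p + r * H r) + (y - r) * (H r + y * Q)              ∎
    where
    H : Carrier → Carrier
    H = horner (q ∷ ps)
    Q : Carrier
    Q = horner (divByRoot r (q ∷ ps)) y

  divByRoot-allZero : ∀ {n} r (ps : Vec Carrier (suc n)) →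
                      All (_≈ 0#) (divByRoot r ps) → horner ps r ≈ 0# → All (_≈ 0#) ps
  divByRoot-allZero r (p ∷ []) [] root = trans (sym (trans (+-congˡ (zeroʳ r)) (+-identityʳ _))) root ∷ []
  divByRoot-allZero r (p ∷ q ∷ ps) (tail-root ∷ rest) root =
    p≈0 ∷ divByRoot-allZero r (q ∷ ps) rest tail-root
    where
    p≈0 : p ≈ 0#
    p≈0 = begin
      p                        ≈⟨ sym (trans (+-congˡ (trans (*-congˡ tail-root) (zeroʳ r))) (+-identityʳ _)) ⟩
      p + r * horner (q ∷ ps) r ≈⟨ root ⟩
      0#                       ∎

  roots⇒allZero : ∀ n (ps : Vec Carrier n) (pts : ℕ → Carrier) →
                  (∀ i j → i < j → j < n → IsRegular (pts j - pts i)) →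
                  (∀ j → j < n → horner ps (pts j) ≈ 0#) → All (_≈ 0#) ps
  roots⇒allZero zero    []  pts regular roots = []
  roots⇒allZero (suc n) ps pts regular roots =
    divByRoot-allZero r ps (roots⇒allZero n qs pts regular′ roots′) (roots n ℕₚ.≤-refl)
    where
    r : Carrier
    r = pts n
    qs : Vec Carrier n
    qs = divByRoot r ps
    regular′ : ∀ i j → i < j → j < n → IsRegular (pts j - pts i)
    regular′ i j i<j j<n = regular i j i<j (ℕₚ.m≤n⇒m≤1+n j<n)
    roots′ : ∀ j → j < n → horner qs (pts j) ≈ 0#
    roots′ j j<n = regular j n j<n ℕₚ.≤-refl _ (begin
      (r - pts j) * horner qs (pts j)         ≈⟨ trans (*-congʳ (sym (⁻¹-anti-homo‿- (pts j) r))) (sym (-‿distribˡ-* _ _)) ⟩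
      - ((pts j - r) * horner qs (pts j))     ≈⟨ -‿cong (begin
          (pts j - r) * horner qs (pts j)               ≈⟨ sym (+-identityˡ _) ⟩
          0# + (pts j - r) * horner qs (pts j)          ≈⟨ +-congʳ (sym (roots n ℕₚ.≤-refl)) ⟩
          horner ps r + (pts j - r) * horner qs (pts j) ≈⟨ sym (horner-divByRoot r ps (pts j)) ⟩
          horner ps (pts j)                             ≈⟨ roots j (ℕₚ.m≤n⇒m≤1+n j<n) ⟩
          0#                                            ∎) ⟩
      - 0#                                    ≈⟨ -0#≈0# ⟩
      0#                                      ∎)

  newtonBasis : (ℕ → Carrier) → ℕ → Carrier → Carrier
  newtonBasis a zero    y = 1#
  newtonBasis a (suc k) y = newtonBasis a k y * (y - a k)

  newton : (ℕ → Carrier) → (ℕ → Carrier) → ℕ → Carrier → Carrier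
  newton a D zero    y = D 0 * newtonBasis a 0 y
  newton a D (suc N) y = newton a D N y + D (suc N) * newtonBasis a (suc N) y

  newtonBasis-unfoldˡ : ∀ a k y → newtonBasis a (suc k) y ≈ (y - a 0) * newtonBasis (a ∘ suc) k y
  newtonBasis-unfoldˡ a zero    y = trans (*-identityˡ _) (sym (*-identityʳ _))
  newtonBasis-unfoldˡ a (suc k) y = trans (*-congʳ (newtonBasis-unfoldˡ a k y)) (*-assoc _ _ _)

  newton-unfoldˡ : ∀ a D N y → newton a D (suc N) y ≈ D 0 + (y - a 0) * newton (a ∘ suc) (D ∘ suc) N y
  newton-unfoldˡ a D zero y =
    +-cong (*-identityʳ _)
           (trans (*-congˡ (*-identityˡ _)) (trans (*-comm _ _) (*-congˡ (sym (*-identityʳ _)))))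
  newton-unfoldˡ a D (suc N) y = begin
    newton a D (suc N) y + D (2 ℕ.+ N) * newtonBasis a (2 ℕ.+ N) y
      ≈⟨ +-cong (newton-unfoldˡ a D N y) (*-congˡ (newtonBasis-unfoldˡ a (suc N) y)) ⟩
    (D 0 + (y - a 0) * T) + D (2 ℕ.+ N) * ((y - a 0) * P)
      ≈⟨ solve 5 (λ d₀ u T d P → (d₀ :+ u :* T) :+ d :* (u :* P) := d₀ :+ u :* (T :+ d :* P))
               refl (D 0) (y - a 0) T (D (2 ℕ.+ N)) P ⟩
    D 0 + (y - a 0) * newton (a ∘ suc) (D ∘ suc) (suc N) y ∎
    where
    T = newton (a ∘ suc) (D ∘ suc) N y
    P = newtonBasis (a ∘ suc) (suc N) y

  newtonCoeffs : (ℕ → Carrier) → (ℕ → Carrier) → (N : ℕ) → Vec Carrier (suc N)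
  newtonCoeffs a D zero    = D 0 ∷ []
  newtonCoeffs a D (suc N) = mulLinear (a 0) (D 0) (newtonCoeffs (a ∘ suc) (D ∘ suc) N)

  horner-newtonCoeffs : ∀ a D N y → horner (newtonCoeffs a D N) y ≈ newton a D N y
  horner-newtonCoeffs a D zero y = trans (+-congˡ (zeroʳ y)) (trans (+-identityʳ _) (sym (*-identityʳ _)))
  horner-newtonCoeffs a D (suc N) y =
    trans (horner-mulLinear (a 0) (D 0) (newtonCoeffs (a ∘ suc) (D ∘ suc) N) y)
          (trans (+-congˡ (*-congˡ (horner-newtonCoeffs (a ∘ suc) (D ∘ suc) N y)))
                 (sym (newton-unfoldˡ a D N y)))

  newtonCoeffs-allZero : ∀ a D N → All (_≈ 0#) (newtonCoeffs a D N) → ∀ k → k ≤ N → D k ≈ 0#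
  newtonCoeffs-allZero a D zero (D₀≈0 ∷ []) zero z≤n = D₀≈0
  newtonCoeffs-allZero a D (suc N) zeros k k≤ with mulLinear-allZero (a 0) (D 0) (newtonCoeffs (a ∘ suc) (D ∘ suc) N) zeros
  newtonCoeffs-allZero a D (suc N) zeros zero    _         | D₀≈0 , _    = D₀≈0
  newtonCoeffs-allZero a D (suc N) zeros (suc k) (s≤s k≤N) | _ , rest   = newtonCoeffs-allZero (a ∘ suc) (D ∘ suc) N rest k k≤N

  newton-− : ∀ a D E N y → newton a D N y - newton a E N y ≈ newton a (λ k → D k - E k) N y
  newton-− a D E zero y = begin
    D 0 * b - E 0 * b      ≈⟨ +-congˡ (-‿distribˡ-* (E 0) b) ⟩
    D 0 * b + (- E 0) * b  ≈⟨ sym (distribʳ b (D 0) (- E 0)) ⟩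
    (D 0 - E 0) * b        ∎
    where b = newtonBasis a 0 y
  newton-− a D E (suc N) y = begin
    (X + d * P) - (Y + e * P)            ≈⟨ +-congˡ (trans (sym (⁻¹-∙-comm Y (e * P))) (+-congˡ (-‿distribˡ-* e P))) ⟩
    (X + d * P) + ((- Y) + (- e) * P)
      ≈⟨ solve 5 (λ X d P nY ne → (X :+ d :* P) :+ (nY :+ ne :* P) := (X :+ nY) :+ (d :+ ne) :* P)
               refl X d P (- Y) (- e) ⟩
    (X - Y) + (d - e) * P                ≈⟨ +-congʳ (newton-− a D E N y) ⟩
    newton a (λ k → D k - E k) N y + (d - e) * P ∎
    where
    X = newton a D N y
    Y = newton a E N y
    d = D (suc N)
    e = E (suc N)
    P = newtonBasis a (suc N) y

  newton-unique : ∀ a (pts : ℕ → Carrier) D E N →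
                  (∀ i j → i < j → j ≤ N → IsRegular (pts j - pts i)) →
                  (∀ j → j ≤ N → newton a D N (pts j) ≈ newton a E N (pts j)) →
                  ∀ k → k ≤ N → D k ≈ E k
  newton-unique a pts D E N regular agree k k≤N =
    x∙y⁻¹≈ε⇒x≈y (D k) (E k) (newtonCoeffs-allZero a (λ k → D k - E k) N coeffs≈0 k k≤N)
    where
    roots : ∀ j → j < suc N → horner (newtonCoeffs a (λ k → D k - E k) N) (pts j) ≈ 0#
    roots j (s≤s j≤N) = begin
      horner (newtonCoeffs a (λ k → D k - E k) N) (pts j) ≈⟨ horner-newtonCoeffs a _ N (pts j) ⟩
      newton a (λ k → D k - E k) N (pts j)                ≈⟨ sym (newton-− a D E N (pts j)) ⟩
      newton a D N (pts j) - newton a E N (pts j)         ≈⟨ +-congʳ (agree j j≤N) ⟩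
      newton a E N (pts j) - newton a E N (pts j)         ≈⟨ -‿inverseʳ _ ⟩
      0#                                                  ∎
    coeffs≈0 : All (_≈ 0#) (newtonCoeffs a (λ k → D k - E k) N)
    coeffs≈0 = roots⇒allZero (suc N) _ pts (λ i j i<j j<1+N → regular i j i<j (ℕₚ.≤-pred j<1+N)) roots

  shift : (ℕ → Carrier) → ℕ → Carrier
  shift D zero    = 0#
  shift D (suc k) = D k

  -- y · N_k(y) = N_{k+1}(y) + a_k N_k(y), with N_k the Newton basis.
  *-newton : ∀ a D N y →
             y * newton a D N y + a (suc N) * D (suc N) * newtonBasis a (suc N) y
               ≈ newton a (λ k → shift D k + a k * D k) (suc N) y
  *-newton a D zero y = begin
    y * (D 0 * 1#) + a 1 * D 1 * (1# * (y - a 0))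
      ≈⟨ sym (+-identityʳ _) ⟩
    y * (D 0 * 1#) + a 1 * D 1 * (1# * (y - a 0)) + 0#
      ≈⟨ +-congˡ (sym (trans (*-congʳ (-‿inverseʳ (a 0))) (zeroˡ (D 0 * 1#)))) ⟩
    y * (D 0 * 1#) + a 1 * D 1 * (1# * (y - a 0)) + (a 0 - a 0) * (D 0 * 1#)
      ≈⟨ solve 7 (λ y d₀ o a₁ d₁ a₀ na₀ → y :* (d₀ :* o) :+ a₁ :* d₁ :* (o :* (y :+ na₀)) :+ (a₀ :+ na₀) :* (d₀ :* o)
                                       := (a₀ :* d₀) :* o :+ (d₀ :+ a₁ :* d₁) :* (o :* (y :+ na₀)))
               refl y (D 0) 1# (a 1) (D 1) (a 0) (- a 0) ⟩
    (a 0 * D 0) * 1# + (D 0 + a 1 * D 1) * (1# * (y - a 0))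
      ≈⟨ +-congʳ (*-congʳ (sym (+-identityˡ _))) ⟩
    (0# + a 0 * D 0) * 1# + (D 0 + a 1 * D 1) * (1# * (y - a 0)) ∎
  *-newton a D (suc N) y = begin
    y * (T + d₁ * P) + a₂ * d₂ * (P * (y - a₁))
      ≈⟨ sym (+-identityʳ _) ⟩
    y * (T + d₁ * P) + a₂ * d₂ * (P * (y - a₁)) + 0#
      ≈⟨ +-congˡ (sym (trans (*-congʳ (-‿inverseʳ a₁)) (zeroˡ (d₁ * P)))) ⟩
    y * (T + d₁ * P) + a₂ * d₂ * (P * (y - a₁)) + (a₁ - a₁) * (d₁ * P)
      ≈⟨ solve 8 (λ y T d₁ P a₂ d₂ a₁ na₁ → y :* (T :+ d₁ :* P) :+ a₂ :* d₂ :* (P :* (y :+ na₁)) :+ (a₁ :+ na₁) :* (d₁ :* P)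
                                          := (y :* T :+ a₁ :* d₁ :* P) :+ (d₁ :+ a₂ :* d₂) :* (P :* (y :+ na₁)))
               refl y T d₁ P a₂ d₂ a₁ (- a₁) ⟩
    (y * T + a₁ * d₁ * P) + (d₁ + a₂ * d₂) * (P * (y - a₁))
      ≈⟨ +-congʳ (*-newton a D N y) ⟩
    newton a (λ k → shift D k + a k * D k) (suc N) y + (d₁ + a₂ * d₂) * (P * (y - a₁)) ∎
    where
    T  = newton a D N y
    P  = newtonBasis a (suc N) y
    a₁ = a (suc N)
    a₂ = a (2 ℕ.+ N)
    d₁ = D (suc N)
    d₂ = D (2 ℕ.+ N)

  newton-recurrence : ∀ (a pts : ℕ → Carrier) D E N →
                      (∀ i j → i < j → IsRegular (pts j - pts i)) →
                      D (suc N) ≈ 0# →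
                      (∀ j → pts j * newton a D N (pts j) ≈ newton a E (suc N) (pts j)) →
                      ∀ k → k ≤ suc N → E k ≈ shift D k + a k * D k
  newton-recurrence a pts D E N regular top≈0 times-y =
    newton-unique a pts E (λ k → shift D k + a k * D k) (suc N) (λ i j i<j _ → regular i j i<j) agree
    where
    agree : ∀ j → j ≤ suc N → newton a E (suc N) (pts j) ≈ newton a (λ k → shift D k + a k * D k) (suc N) (pts j)
    agree j _ = begin
      newton a E (suc N) y                                          ≈⟨ sym (times-y j) ⟩
      y * newton a D N y                                            ≈⟨ sym (+-identityʳ _) ⟩
      y * newton a D N y + 0#
        ≈⟨ +-congˡ (sym (trans (*-congʳ (trans (*-congˡ top≈0) (zeroʳ _))) (zeroˡ _))) ⟩
      y * newton a D N y + a (suc N) * D (suc N) * newtonBasis a (suc N) y ≈⟨ *-newton a D N y ⟩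
      newton a (λ k → shift D k + a k * D k) (suc N) y              ∎
      where y = pts j

open import Defs
open import Data.Integer using (ℤ; +_; _+_; _*_; _-_; -_)
import Data.Integer.Properties as ℤₚ
open import Data.Integer.Tactic.RingSolver using (solve-∀; solve)
open import Data.List using (_∷_; [])
open import Data.Nat.Combinatorics using (nCk+nC[k+1]≡[n+1]C[k+1]; nC1≡n)
open import Data.Nat.Induction using (<-rec)
open import Data.Sum using (inj₁; inj₂)
open import Relation.Nullary using (yes; no)
open import Relation.Binary.PropositionalEquality

sumTo-congᵇ : ∀ n {f g : ℕ → ℤ} → (∀ i → i ≤ n → f i ≡ g i) → sumTo n f ≡ sumTo n g
sumTo-congᵇ zero    f≡g = f≡g 0 z≤n
sumTo-congᵇ (suc n) f≡g =
  cong₂ _+_ (sumTo-congᵇ n (λ i i≤n → f≡g i (ℕₚ.m≤n⇒m≤1+n i≤n))) (f≡g (suc n) ℕₚ.≤-refl)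

sumTo-cong : ∀ n {f g : ℕ → ℤ} → (∀ i → f i ≡ g i) → sumTo n f ≡ sumTo n g
sumTo-cong n f≡g = sumTo-congᵇ n (λ i _ → f≡g i)

sumTo-zero : ∀ n {f : ℕ → ℤ} → (∀ i → i ≤ n → f i ≡ + 0) → sumTo n f ≡ + 0
sumTo-zero zero    f≡0 = f≡0 0 z≤n
sumTo-zero (suc n) f≡0 =
  cong₂ _+_ (sumTo-zero n (λ i i≤n → f≡0 i (ℕₚ.m≤n⇒m≤1+n i≤n))) (f≡0 (suc n) ℕₚ.≤-refl)

sumTo-unfoldˡ : ∀ n (f : ℕ → ℤ) → sumTo (suc n) f ≡ f 0 + sumTo n (f ∘ suc)
sumTo-unfoldˡ zero    f = refl
sumTo-unfoldˡ (suc n) f = trans (cong (_+ f (2 ℕ.+ n)) (sumTo-unfoldˡ n f)) (ℤₚ.+-assoc (f 0) _ _)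

sumTo-reverse : ∀ n (f : ℕ → ℤ) → sumTo n f ≡ sumTo n (λ i → f (n ∸ i))
sumTo-reverse zero    f = refl
sumTo-reverse (suc n) f = begin
  sumTo (suc n) f                               ≡⟨ sumTo-unfoldˡ n f ⟩
  f 0 + sumTo n (f ∘ suc)                       ≡⟨ cong (λ x → f 0 + x) (sumTo-reverse n (f ∘ suc)) ⟩
  f 0 + sumTo n (λ i → f (suc (n ∸ i)))         ≡⟨ ℤₚ.+-comm (f 0) _ ⟩
  sumTo n (λ i → f (suc (n ∸ i))) + f 0         ≡⟨ cong₂ _+_ (sumTo-congᵇ n (λ i i≤n → cong f (sym (ℕₚ.+-∸-assoc 1 i≤n))))
                                                             (cong f (sym (ℕₚ.n∸n≡0 n))) ⟩
  sumTo n (λ i → f (suc n ∸ i)) + f (suc n ∸ suc n) ∎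
  where open ≡-Reasoning

sumTo-+ : ∀ n (f g : ℕ → ℤ) → sumTo n (λ i → f i + g i) ≡ sumTo n f + sumTo n g
sumTo-+ zero    f g = refl
sumTo-+ (suc n) f g = trans (cong (_+ (f (suc n) + g (suc n))) (sumTo-+ n f g))
                            (interchange (sumTo n f) (sumTo n g) (f (suc n)) (g (suc n)))
  where
  interchange : ∀ a b c d → (a + b) + (c + d) ≡ (a + c) + (b + d)
  interchange = solve-∀

sumTo-*ˡ : ∀ n c (f : ℕ → ℤ) → sumTo n (λ i → c * f i) ≡ c * sumTo n f
sumTo-*ˡ zero    c f = refl
sumTo-*ˡ (suc n) c f = trans (cong (_+ (c * f (suc n))) (sumTo-*ˡ n c f)) (sym (ℤₚ.*-distribˡ-+ c _ _))

sumTo-last : ∀ n (f : ℕ → ℤ) → (∀ i → i < n → f i ≡ + 0) → sumTo n f ≡ f n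
sumTo-last zero    f _   = refl
sumTo-last (suc n) f f≡0 = trans (cong (_+ f (suc n)) (sumTo-zero n (λ i i≤n → f≡0 i (s≤s i≤n)))) (ℤₚ.+-identityˡ _)

sumTo-truncate : ∀ {m n} (f : ℕ → ℤ) → m ≤ n → (∀ i → m < i → i ≤ n → f i ≡ + 0) → sumTo n f ≡ sumTo m f
sumTo-truncate {n = zero}  f z≤n   _   = refl
sumTo-truncate {m} {suc n} f m≤1+n f≡0 with ℕₚ.m≤n⇒m<n∨m≡n m≤1+n
... | inj₂ refl    = refl
... | inj₁ m<1+n = begin
  sumTo n f + f (suc n) ≡⟨ cong₂ _+_ (sumTo-truncate f m≤n (λ i m<i i≤n → f≡0 i m<i (ℕₚ.m≤n⇒m≤1+n i≤n)))
                                    (f≡0 (suc n) m<1+n ℕₚ.≤-refl) ⟩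
  sumTo m f + + 0       ≡⟨ ℤₚ.+-identityʳ _ ⟩
  sumTo m f             ∎
  where
  open ≡-Reasoning
  m≤n : m ≤ n
  m≤n = ℕₚ.≤-pred m<1+n

infix 4 _≈S_
_≈S_ : Series → Series → Set
f ≈S g = ∀ s → f s ≡ g s

negS : Series → Series
negS f s = - f s

⊛-unfoldˡ : ∀ f g s → (f ⊛ g) (suc s) ≡ f 0 * g (suc s) + ((f ∘ suc) ⊛ g) s
⊛-unfoldˡ f g s = sumTo-unfoldˡ s (λ i → f i * g (suc s ∸ i))

⊛-cong : ∀ {f f′ g g′} → f ≈S f′ → g ≈S g′ → (f ⊛ g) ≈S (f′ ⊛ g′)
⊛-cong f≈f′ g≈g′ s = sumTo-cong s (λ i → cong₂ _*_ (f≈f′ i) (g≈g′ (s ∸ i)))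

⊛-congˡ : ∀ {f f′} g → f ≈S f′ → (f ⊛ g) ≈S (f′ ⊛ g)
⊛-congˡ {f} {f′} g f≈f′ = ⊛-cong {f} {f′} {g} {g} f≈f′ (λ _ → refl)

⊛-congʳ : ∀ f {g g′} → g ≈S g′ → (f ⊛ g) ≈S (f ⊛ g′)
⊛-congʳ f {g} {g′} = ⊛-cong {f} {f} {g} {g′} (λ _ → refl)

⊛-distribʳ : ∀ h f g → ((f ⊕ g) ⊛ h) ≈S ((f ⊛ h) ⊕ (g ⊛ h))
⊛-distribʳ h f g s = trans (sumTo-cong s (λ i → ℤₚ.*-distribʳ-+ (h (s ∸ i)) (f i) (g i))) (sumTo-+ s _ _)

⊛-distribˡ : ∀ h f g → (h ⊛ (f ⊕ g)) ≈S ((h ⊛ f) ⊕ (h ⊛ g))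
⊛-distribˡ h f g s = trans (sumTo-cong s (λ i → ℤₚ.*-distribˡ-+ (h i) (f (s ∸ i)) (g (s ∸ i)))) (sumTo-+ s _ _)

⊛-comm : ∀ f g → (f ⊛ g) ≈S (g ⊛ f)
⊛-comm f g s = trans (sumTo-reverse s _) (sumTo-congᵇ s (λ i i≤s →
  trans (cong (λ j → f (s ∸ i) * g j) (ℕₚ.m∸[m∸n]≡n i≤s)) (ℤₚ.*-comm (f (s ∸ i)) (g i))))

⊛-assoc : ∀ f g h → ((f ⊛ g) ⊛ h) ≈S (f ⊛ (g ⊛ h))
⊛-assoc f g h zero    = ℤₚ.*-assoc (f 0) (g 0) (h 0)
⊛-assoc f g h (suc s) = begin
  ((f ⊛ g) ⊛ h) (suc s)                          ≡⟨ ⊛-unfoldˡ (f ⊛ g) h s ⟩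
  (f 0 * g 0) * h (suc s) + (((f ⊛ g) ∘ suc) ⊛ h) s ≡⟨ cong (λ x → (f 0 * g 0) * h (suc s) + x) tail-assoc ⟩
  (f 0 * g 0) * h (suc s) + (f 0 * ((g ∘ suc) ⊛ h) s + ((f ∘ suc) ⊛ (g ⊛ h)) s)
    ≡⟨ regroup (f 0) (g 0) (h (suc s)) (((g ∘ suc) ⊛ h) s) (((f ∘ suc) ⊛ (g ⊛ h)) s) ⟩
  f 0 * (g 0 * h (suc s) + ((g ∘ suc) ⊛ h) s) + ((f ∘ suc) ⊛ (g ⊛ h)) s
    ≡⟨ cong (λ x → f 0 * x + ((f ∘ suc) ⊛ (g ⊛ h)) s) (sym (⊛-unfoldˡ g h s)) ⟩
  f 0 * (g ⊛ h) (suc s) + ((f ∘ suc) ⊛ (g ⊛ h)) s ≡⟨ sym (⊛-unfoldˡ f (g ⊛ h) s) ⟩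
  (f ⊛ (g ⊛ h)) (suc s)                          ∎
  where
  open ≡-Reasoning
  regroup : ∀ a b c d e → (a * b) * c + (a * d + e) ≡ a * (b * c + d) + e
  regroup = solve-∀
  scale : ℤ → Series → Series
  scale c f s = c * f s
  scale-⊛ : ∀ c f → (scale c f ⊛ h) ≈S scale c (f ⊛ h)
  scale-⊛ c f s = trans (sumTo-cong s (λ i → ℤₚ.*-assoc c (f i) (h (s ∸ i)))) (sumTo-*ˡ s c _)
  tail-assoc : (((f ⊛ g) ∘ suc) ⊛ h) s ≡ f 0 * ((g ∘ suc) ⊛ h) s + ((f ∘ suc) ⊛ (g ⊛ h)) s
  tail-assoc = begin
    (((f ⊛ g) ∘ suc) ⊛ h) s                         ≡⟨ ⊛-congˡ h (⊛-unfoldˡ f g) s ⟩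
    ((scale (f 0) (g ∘ suc) ⊕ ((f ∘ suc) ⊛ g)) ⊛ h) s ≡⟨ ⊛-distribʳ h (scale (f 0) (g ∘ suc)) ((f ∘ suc) ⊛ g) s ⟩
    (scale (f 0) (g ∘ suc) ⊛ h) s + (((f ∘ suc) ⊛ g) ⊛ h) s
      ≡⟨ cong₂ _+_ (scale-⊛ (f 0) (g ∘ suc) s) (⊛-assoc (f ∘ suc) g h s) ⟩
    f 0 * ((g ∘ suc) ⊛ h) s + ((f ∘ suc) ⊛ (g ⊛ h)) s ∎

⊛-identityˡ : ∀ f → (1S ⊛ f) ≈S f
⊛-identityˡ f zero    = ℤₚ.*-identityˡ (f 0)
⊛-identityˡ f (suc s) = trans (⊛-unfoldˡ 1S f s)
  (trans (cong₂ _+_ (ℤₚ.*-identityˡ (f (suc s))) (sumTo-zero s (λ i _ → ℤₚ.*-zeroˡ (f (s ∸ i)))))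
         (ℤₚ.+-identityʳ (f (suc s))))

⊛-identityʳ : ∀ f → (f ⊛ 1S) ≈S f
⊛-identityʳ f s = trans (⊛-comm f 1S s) (⊛-identityˡ f s)

⊛-zeroʳ : ∀ f {g} → g ≈S 0S → (f ⊛ g) ≈S 0S
⊛-zeroʳ f g≈0 s = sumTo-zero s (λ i _ → trans (cong (f i *_) (g≈0 (s ∸ i))) (ℤₚ.*-zeroʳ (f i)))

seriesRing : CommutativeRing _ _
seriesRing = record
  { Carrier = Series
  ; _≈_     = _≈S_
  ; _+_     = _⊕_
  ; _*_     = _⊛_
  ; -_      = negS
  ; 0#      = 0S
  ; 1#      = 1S
  ; isCommutativeRing = record
    { isRing = record
      { +-isAbelianGroup = record
        { isGroup = record
          { isMonoid = record
            { isSemigroup = record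
              { isMagma = record
                { isEquivalence = record
                  { refl  = λ _ → refl
                  ; sym   = λ f≈g s → sym (f≈g s)
                  ; trans = λ f≈g g≈h s → trans (f≈g s) (g≈h s)
                  }
                ; ∙-cong = λ f≈f′ g≈g′ s → cong₂ _+_ (f≈f′ s) (g≈g′ s)
                }
              ; assoc = λ f g h s → ℤₚ.+-assoc (f s) (g s) (h s)
              }
            ; identity = (λ f s → ℤₚ.+-identityˡ (f s)) , (λ f s → ℤₚ.+-identityʳ (f s))
            }
          ; inverse = (λ f s → ℤₚ.+-inverseˡ (f s)) , (λ f s → ℤₚ.+-inverseʳ (f s))
          ; ⁻¹-cong = λ f≈g s → cong -_ (f≈g s)
          }
        ; comm = λ f g s → ℤₚ.+-comm (f s) (g s)
        }
      ; *-cong     = ⊛-cong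
      ; *-assoc    = ⊛-assoc
      ; *-identity = ⊛-identityˡ , ⊛-identityʳ
      ; distrib    = ⊛-distribˡ , ⊛-distribʳ
      }
    ; *-comm = ⊛-comm
    }
  }

open NewtonInterpolation seriesRing using (IsRegular; newton; newtonBasis; shift; newton-recurrence)

qint-< : ∀ {t x} → t < x → qint x t ≡ + 1
qint-< {zero}  {suc x} _         = refl
qint-< {suc t} {suc x} (s≤s t<x) = qint-< t<x

qint-≥ : ∀ {t x} → x ≤ t → qint x t ≡ + 0
qint-≥ {t}     {zero}  _         = refl
qint-≥ {suc t} {suc x} (s≤s x≤t) = qint-≥ x≤t

qint-⊛-prefix : ∀ {m s} (f : Series) → s < m → (qint m ⊛ f) s ≡ sumTo s f
qint-⊛-prefix {m} {s} f s<m = begin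
  sumTo s (λ i → qint m i * f (s ∸ i)) ≡⟨ sumTo-congᵇ s (λ i i≤s → trans (cong (_* f (s ∸ i)) (qint-< (ℕₚ.≤-<-trans i≤s s<m)))
                                                                        (ℤₚ.*-identityˡ _)) ⟩
  sumTo s (λ i → f (s ∸ i))            ≡⟨ sym (sumTo-reverse s f) ⟩
  sumTo s f                            ∎
  where open ≡-Reasoning

qint-⊛-window : ∀ m s (f : Series) → (qint (suc m) ⊛ f) (m ℕ.+ s) ≡ sumTo m (λ t → f (t ℕ.+ s))
qint-⊛-window m s f = begin
  sumTo (m ℕ.+ s) (λ i → qint (suc m) i * f (m ℕ.+ s ∸ i))
    ≡⟨ sumTo-truncate _ (ℕₚ.m≤m+n m s)
                      (λ i m<i _ → trans (cong (_* f (m ℕ.+ s ∸ i)) (qint-≥ m<i)) (ℤₚ.*-zeroˡ (f (m ℕ.+ s ∸ i)))) ⟩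
  sumTo m (λ i → qint (suc m) i * f (m ℕ.+ s ∸ i))
    ≡⟨ sumTo-congᵇ m (λ i i≤m → trans (cong (_* f (m ℕ.+ s ∸ i)) (qint-< (s≤s i≤m)))
                                      (trans (ℤₚ.*-identityˡ _) (cong f (ℕₚ.+-∸-comm s i≤m)))) ⟩
  sumTo m (λ i → f ((m ∸ i) ℕ.+ s))
    ≡⟨ sumTo-reverse m _ ⟩
  sumTo m (λ i → f ((m ∸ (m ∸ i)) ℕ.+ s))
    ≡⟨ sumTo-congᵇ m (λ i i≤m → cong (λ j → f (j ℕ.+ s)) (ℕₚ.m∸[m∸n]≡n i≤m)) ⟩
  sumTo m (λ t → f (t ℕ.+ s))
    ∎
  where open ≡-Reasoning

-- The convolution at degree m + s only sees r s, since g vanishes below degree m and r (by induction) below s.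
lowest-one⇒regular : ∀ (g : Series) m → (∀ t → t < m → g t ≡ + 0) → g m ≡ + 1 → IsRegular g
lowest-one⇒regular g m g≡0 g≡1 r gr≈0 = <-rec (λ t → r t ≡ + 0) step
  where
  step : ∀ s → (∀ {t} → t < s → r t ≡ + 0) → r s ≡ + 0
  step s r≡0 = begin
    r s                           ≡⟨ sym (ℤₚ.*-identityʳ (r s)) ⟩
    r s * + 1                     ≡⟨ cong (r s *_) (sym g≡1) ⟩
    r s * g m                     ≡⟨ cong (λ j → r s * g j) (sym (ℕₚ.m+n∸n≡m m s)) ⟩
    term s                        ≡⟨ sym (sumTo-last s term low-terms) ⟩
    sumTo s term                  ≡⟨ sym (sumTo-truncate term (ℕₚ.m≤n+m s m) high-terms) ⟩
    sumTo (m ℕ.+ s) term          ≡⟨ sym (⊛-comm g r (m ℕ.+ s)) ⟩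
    (g ⊛ r) (m ℕ.+ s)             ≡⟨ gr≈0 (m ℕ.+ s) ⟩
    + 0                           ∎
    where
    open ≡-Reasoning
    term : ℕ → ℤ
    term i = r i * g (m ℕ.+ s ∸ i)
    low-terms : ∀ t → t < s → term t ≡ + 0
    low-terms t t<s = trans (cong (_* g (m ℕ.+ s ∸ t)) (r≡0 t<s)) (ℤₚ.*-zeroˡ (g (m ℕ.+ s ∸ t)))
    high-terms : ∀ i → s < i → i ≤ m ℕ.+ s → term i ≡ + 0
    high-terms i s<i i≤m+s = trans (cong (r i *_) (g≡0 _ below-m)) (ℤₚ.*-zeroʳ (r i))
      where
      below-m : m ℕ.+ s ∸ i < m
      below-m = subst (m ℕ.+ s ∸ i <_) (ℕₚ.m+n∸n≡m m s) (ℕₚ.∸-monoʳ-< s<i i≤m+s)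

qint-difference-regular : ∀ {i j} → i < j → IsRegular (qint (suc j) ⊖ qint (suc i))
qint-difference-regular {i} {j} i<j = lowest-one⇒regular _ (suc i) below at
  where
  below : ∀ t → t < suc i → qint (suc j) t - qint (suc i) t ≡ + 0
  below t t≤i rewrite qint-< (ℕₚ.<-≤-trans t≤i (s≤s (ℕₚ.<⇒≤ i<j))) | qint-< t≤i = refl
  at : qint (suc j) (suc i) - qint (suc i) (suc i) ≡ + 1
  at rewrite qint-< (s≤s i<j) | qint-≥ (ℕₚ.≤-refl {suc i}) = refl

fib-≤-suc : ∀ n → fib n ≤ fib (suc n)
fib-≤-suc zero    = z≤n
fib-≤-suc (suc n) = ℕₚ.m≤m+n (fib (suc n)) (fib n)

fib-mono : ∀ {m n} → m ≤ n → fib m ≤ fib n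
fib-mono {n = zero} z≤n = ℕₚ.≤-refl
fib-mono {m} {suc n} m≤1+n with ℕₚ.m≤n⇒m<n∨m≡n m≤1+n
... | inj₁ m<1+n = ℕₚ.≤-trans (fib-mono (ℕₚ.≤-pred m<1+n)) (fib-≤-suc n)
... | inj₂ refl  = ℕₚ.≤-refl

fib-bound : ∀ {s c k} → s < fib c → c ≤ k → s < fib k
fib-bound s<Fc c≤k = ℕₚ.<-≤-trans s<Fc (fib-mono c≤k)

0<fib-suc : ∀ k → 0 < fib (suc k)
0<fib-suc k = fib-bound {c = 1} {k = suc k} ℕₚ.≤-refl (s≤s z≤n)

binomPred-pascal : ∀ n j → binomPred (suc n) (suc j) ≡ binomPred n j + binomPred n (suc j)
binomPred-pascal zero    j = refl
binomPred-pascal (suc n) j = cong +_ (sym (nCk+nC[k+1]≡[n+1]C[k+1] n j))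

bin-pascal : ∀ m j → bin (suc m) (suc j) ≡ bin m j + bin m (suc j)
bin-pascal m j = cong +_ (sym (nCk+nC[k+1]≡[n+1]C[k+1] m j))

bin-suc-2 : ∀ m → bin (suc m) 2 ≡ + m + bin m 2
bin-suc-2 m = trans (bin-pascal m 1) (cong (λ x → x + bin m 2) (cong +_ (nC1≡n m)))

vanishes₂ : ∀ a b → a * + 0 + b * + 0 ≡ + 0
vanishes₂ = solve-∀

vanishes₃ : ∀ a b c → a * + 0 + b * + 0 + c * + 0 ≡ + 0
vanishes₃ = solve-∀

vanishes₄ : ∀ a b c d → a * + 0 + b * + 0 + c * + 0 + d * + 0 ≡ + 0
vanishes₄ = solve-∀

-- The ring identities behind the induction steps, with the instances of Pascal's rule they use as
-- hypotheses: Xᵢ stands for binomPred n (k + i), Yᵢ for binomPred (1 + n) (k + 1 + i), M for + m and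
-- cᵢⱼ for bin (i + m) j.

coeff₁-step : ∀ M {X₀ X₁ Y₀} → Y₀ ≡ X₀ + X₁ →
              M * X₀ + (X₀ + (+ 1 + M) * X₁) ≡ (+ 1 + M) * Y₀
coeff₁-step M {X₀} {X₁} refl = solve (M ∷ X₀ ∷ X₁ ∷ [])

coeff₂-step : ∀ M c₂₂ c₃₂ {X₀ X₁ X₂ Y₀ Y₁} →
              c₃₂ ≡ (+ 2 + M) + c₂₂ → Y₀ ≡ X₀ + X₁ → Y₁ ≡ X₁ + X₂ →
              (M * X₀ + c₂₂ * X₁) + ((X₀ + (+ 2 + M) * X₁) + ((+ 1 + M) * X₁ + c₃₂ * X₂))
                ≡ (+ 1 + M) * Y₀ + c₃₂ * Y₁
coeff₂-step M c₂₂ _ {X₀} {X₁} {X₂} refl refl refl = solve (M ∷ c₂₂ ∷ X₀ ∷ X₁ ∷ X₂ ∷ [])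

coeff₃-base : ∀ X₀ X₁ X₂ X₃ {Y₀ Y₁ Y₂} →
              Y₀ ≡ X₀ + X₁ → Y₁ ≡ X₁ + X₂ → Y₂ ≡ X₂ + X₃ →
              X₂ + ((+ 2 * X₁ + (+ 1 * X₁ + + 3 * X₂)) + (+ 0 * X₁ + + 3 * X₂ + + 4 * X₃))
                ≡ + 0 * Y₀ + + 3 * Y₁ + + 4 * Y₂
coeff₃-base X₀ X₁ X₂ X₃ refl refl refl = solve (X₀ ∷ X₁ ∷ X₂ ∷ X₃ ∷ [])

coeff₃-step : ∀ M c₂₂ c₃₂ c₄₂ c₄₃ c₅₃ {X₀ X₁ X₂ X₃ Y₀ Y₁ Y₂} →
              c₃₂ ≡ (+ 2 + M) + c₂₂ → c₄₂ ≡ (+ 3 + M) + c₃₂ → c₅₃ ≡ c₄₂ + c₄₃ →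
              Y₀ ≡ X₀ + X₁ → Y₁ ≡ X₁ + X₂ → Y₂ ≡ X₂ + X₃ →
              (M * X₀ + (c₃₂ + c₂₂ - + 1) * X₁ + c₄₃ * X₂)
                + (((X₀ + (+ 3 + M) * X₁) + ((+ 2 + M) * X₁ + c₄₂ * X₂))
                   + ((+ 1 + M) * X₁ + (c₄₂ + c₃₂ - + 1) * X₂ + c₅₃ * X₃))
                ≡ (+ 1 + M) * Y₀ + (c₄₂ + c₃₂ - + 1) * Y₁ + c₅₃ * Y₂
coeff₃-step M c₂₂ _ _ c₄₃ _ {X₀} {X₁} {X₂} {X₃} refl refl refl refl refl refl =
  solve (M ∷ c₂₂ ∷ c₄₃ ∷ X₀ ∷ X₁ ∷ X₂ ∷ X₃ ∷ [])

coeff₄-base : ∀ X₀ X₁ X₂ X₃ X₄ {Y₀ Y₁ Y₂ Y₃} →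
              Y₀ ≡ X₀ + X₁ → Y₁ ≡ X₁ + X₂ → Y₂ ≡ X₂ + X₃ → Y₃ ≡ X₃ + X₄ →
              X₃ + ((+ 1 * X₁ + + 3 * X₂) + (+ 0 * X₁ + + 3 * X₂ + + 4 * X₃)
                    + (+ 0 * X₁ + + 1 * X₂ + + 6 * X₃ + + 5 * X₄))
                ≡ + 0 * Y₀ + + 1 * Y₁ + + 6 * Y₂ + + 5 * Y₃
coeff₄-base X₀ X₁ X₂ X₃ X₄ refl refl refl refl = solve (X₀ ∷ X₁ ∷ X₂ ∷ X₃ ∷ X₄ ∷ [])

coeff₄-step : ∀ M c₁₂ c₂₂ c₃₂ c₄₂ c₃₃ c₄₃ c₅₃ c₅₄ c₆₄ {X₀ X₁ X₂ X₃ X₄ Y₀ Y₁ Y₂ Y₃} →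
              c₂₂ ≡ (+ 1 + M) + c₁₂ → c₃₂ ≡ (+ 2 + M) + c₂₂ → c₄₂ ≡ (+ 3 + M) + c₃₂ →
              c₄₃ ≡ c₃₂ + c₃₃ → c₅₃ ≡ c₄₂ + c₄₃ → c₆₄ ≡ c₅₃ + c₅₄ →
              Y₀ ≡ X₀ + X₁ → Y₁ ≡ X₁ + X₂ → Y₂ ≡ X₂ + X₃ → Y₃ ≡ X₃ + X₄ →
              (M * X₀ + (c₃₂ + c₂₂ + c₁₂ - + 3) * X₁ + (+ 2 * c₄₃ + c₃₃ - (+ 4 + M) + + 1) * X₂ + c₅₄ * X₃)
                + ((((X₀ + (+ 3 + M) * X₁) + ((+ 2 + M) * X₁ + c₄₂ * X₂))
                    + ((+ 1 + M) * X₁ + (c₄₂ + c₃₂ - + 1) * X₂ + c₅₃ * X₃))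
                   + ((+ 1 + M) * X₁ + (c₄₂ + c₃₂ + c₂₂ - + 3) * X₂
                      + (+ 2 * c₅₃ + c₄₃ - (+ 5 + M) + + 1) * X₃ + c₆₄ * X₄))
                ≡ (+ 1 + M) * Y₀ + (c₄₂ + c₃₂ + c₂₂ - + 3) * Y₁
                  + (+ 2 * c₅₃ + c₄₃ - (+ 5 + M) + + 1) * Y₂ + c₆₄ * Y₃
coeff₄-step M c₁₂ _ _ _ c₃₃ _ _ c₅₄ _ {X₀} {X₁} {X₂} {X₃} {X₄} refl refl refl refl refl refl refl refl refl refl =
  solve (M ∷ c₁₂ ∷ c₃₃ ∷ c₅₄ ∷ X₀ ∷ X₁ ∷ X₂ ∷ X₃ ∷ X₄ ∷ [])

module Expansion (SF : ℕ → ℕ → Series) (isSF : IsSF SF) where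

  points : ℕ → Series
  points j = qint (suc j)

  nodes : ℕ → Series
  nodes k = qint (fib k)

  SF-above-diagonal : ∀ {n k} → n < k → SF n k ≈S 0S
  SF-above-diagonal {n} {k} = proj₁ isSF n k

  newtonBasis-fibFall : ∀ x k → newtonBasis nodes k (qint x) ≈S fibFall x k
  newtonBasis-fibFall x zero    _ = refl
  newtonBasis-fibFall x (suc k)   = ⊛-congˡ (qint x ⊖ qint (fib k)) (newtonBasis-fibFall x k)

  newton-sumSer : ∀ D N x → newton nodes D N (qint x) ≈S sumSer N (λ k → D k ⊛ fibFall x k)
  newton-sumSer D zero    x   = ⊛-congʳ (D 0) (newtonBasis-fibFall x 0)
  newton-sumSer D (suc N) x s =
    cong₂ _+_ (newton-sumSer D N x s) (⊛-congʳ (D (suc N)) (newtonBasis-fibFall x (suc N)) s)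

  power-newton : ∀ n j → (points j ^S n) ≈S newton nodes (SF n) n (points j)
  power-newton n j s = trans (proj₂ isSF n (suc j) (s≤s z≤n) s) (sym (newton-sumSer (SF n) n (suc j) s))

  SF-recurrence : ∀ n k → k ≤ suc n → SF (suc n) k ≈S (shift (SF n) k ⊕ (nodes k ⊛ SF n k))
  SF-recurrence n =
    newton-recurrence nodes points (SF n) (SF (suc n)) n
      (λ i j → qint-difference-regular)
      (SF-above-diagonal ℕₚ.≤-refl)
      (λ j s → trans (⊛-congʳ (points j) (λ t → sym (power-newton n j t)) s) (power-newton (suc n) j s))

  SF-0-0 : SF 0 0 ≈S 1S
  SF-0-0 s = trans (sym (⊛-identityʳ (SF 0 0) s)) (sym (proj₂ isSF 0 1 (s≤s z≤n) s))

  SF-suc-0 : ∀ n → SF (suc n) 0 ≈S 0S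
  SF-suc-0 n s = trans (SF-recurrence n 0 z≤n s)
                       (trans (ℤₚ.+-identityˡ _) (sumTo-zero s (λ i _ → ℤₚ.*-zeroˡ (SF n 0 (s ∸ i)))))

  SF-suc-suc : ∀ n k → SF (suc n) (suc k) ≈S (SF n k ⊕ (nodes (suc k) ⊛ SF n (suc k)))
  SF-suc-suc n k with k ℕ.≤? n
  ... | yes k≤n = SF-recurrence n (suc k) (s≤s k≤n)
  ... | no  k≰n = λ s → trans (SF-above-diagonal (s≤s n<k) s)
      (sym (cong₂ _+_ (SF-above-diagonal n<k s)
                      (⊛-zeroʳ (nodes (suc k)) (SF-above-diagonal (ℕₚ.m≤n⇒m≤1+n n<k)) s)))
    where
    n<k : n < k
    n<k = ℕₚ.≰⇒> k≰n

  SF-prefix : ∀ n k {s} → s < fib (suc k) → SF (suc n) (suc k) s ≡ SF n k s + sumTo s (SF n (suc k))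
  SF-prefix n k {s} s<F =
    trans (SF-suc-suc n k s) (cong (λ x → SF n k s + x) (qint-⊛-prefix (SF n (suc k)) s<F))

  SF-window : ∀ n k m s → fib (suc k) ≡ suc m →
              SF (suc n) (suc k) (m ℕ.+ s) ≡ SF n k (m ℕ.+ s) + sumTo m (λ t → SF n (suc k) (t ℕ.+ s))
  SF-window n k m s F≡1+m =
    trans (SF-suc-suc n k (m ℕ.+ s))
          (cong (λ x → SF n k (m ℕ.+ s) + x)
                (trans (cong (λ F → (qint F ⊛ SF n (suc k)) (m ℕ.+ s)) F≡1+m) (qint-⊛-window m s (SF n (suc k)))))

  SF-0-suc≡0 : ∀ n s → SF n 0 (suc s) ≡ + 0
  SF-0-suc≡0 zero    s = SF-0-0 (suc s)
  SF-0-suc≡0 (suc n) s = SF-suc-0 n (suc s)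

  SF-1-suc≡0 : ∀ n s → SF n 1 (suc s) ≡ + 0
  SF-1-suc≡0 zero    s = SF-above-diagonal (s≤s z≤n) (suc s)
  SF-1-suc≡0 (suc n) s = trans (SF-window n 0 0 (suc s) refl) (cong₂ _+_ (SF-0-suc≡0 n s) (SF-1-suc≡0 n s))

  SF-2-suc≡0 : ∀ n s → SF n 2 (suc s) ≡ + 0
  SF-2-suc≡0 zero    s = SF-above-diagonal (s≤s z≤n) (suc s)
  SF-2-suc≡0 (suc n) s = trans (SF-window n 1 0 (suc s) refl) (cong₂ _+_ (SF-1-suc≡0 n s) (SF-2-suc≡0 n s))

  SF-1+k-0 : ∀ n k → SF n (suc k) 0 ≡ binomPred n k
  SF-1+k-0 zero    k       = SF-above-diagonal (s≤s z≤n) 0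
  SF-1+k-0 (suc n) zero    =
    trans (SF-prefix n 0 (0<fib-suc 0)) (trans (cong (λ x → SF n 0 0 + x) (SF-1+k-0 n 0)) (column₀ n))
    where
    column₀ : ∀ m → SF m 0 0 + binomPred m 0 ≡ + 1
    column₀ zero    = cong (λ x → x + + 0) (SF-0-0 0)
    column₀ (suc m) = cong (λ x → x + + 1) (SF-suc-0 m 0)
  SF-1+k-0 (suc n) (suc k) =
    trans (SF-prefix n (suc k) (0<fib-suc (suc k)))
          (trans (cong₂ _+_ (SF-1+k-0 n k) (SF-1+k-0 n (suc k))) (sym (binomPred-pascal n k)))

  SF-3-s : ∀ n s → SF n 3 s ≡ binomPred n (2 ℕ.+ s)
  SF-3-s zero    s       = SF-above-diagonal (s≤s z≤n) s
  SF-3-s (suc n) zero    =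
    trans (SF-prefix n 2 (0<fib-suc 2))
          (trans (cong₂ _+_ (SF-1+k-0 n 1) (SF-3-s n 0)) (sym (binomPred-pascal n 1)))
  SF-3-s (suc n) (suc s) =
    trans (SF-window n 2 1 s refl)
          (trans (cong₂ _+_ (SF-2-suc≡0 n s) (cong₂ _+_ (SF-3-s n s) (SF-3-s n (suc s))))
                 (trans (ℤₚ.+-identityˡ _) (sym (binomPred-pascal n (2 ℕ.+ s)))))

  SF-2+m-1 : ∀ n m → SF n (2 ℕ.+ m) 1 ≡ + m * binomPred n (2 ℕ.+ m)
  SF-2+m-1 zero    m       = trans (SF-above-diagonal (s≤s z≤n) 1) (sym (ℤₚ.*-zeroʳ (+ m)))
  SF-2+m-1 (suc n) zero    = trans (SF-window n 1 0 1 refl) (cong₂ _+_ (SF-1-suc≡0 n 0) (SF-2-suc≡0 n 0))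
  SF-2+m-1 (suc n) (suc m) =
    trans (SF-prefix n (2 ℕ.+ m) (fib-bound ℕₚ.≤-refl (ℕₚ.m≤m+n 3 m)))
          (trans (cong₂ _+_ (SF-2+m-1 n m) (cong₂ _+_ (SF-1+k-0 n (2 ℕ.+ m)) (SF-2+m-1 n (suc m))))
                 (coeff₁-step (+ m) (binomPred-pascal n (2 ℕ.+ m))))

  SF-3+m-2 : ∀ n m → SF n (3 ℕ.+ m) 2 ≡ + m * binomPred n (3 ℕ.+ m) + bin (2 ℕ.+ m) 2 * binomPred n (4 ℕ.+ m)
  SF-3+m-2 zero    m       = trans (SF-above-diagonal (s≤s z≤n) 2) (sym (vanishes₂ (+ m) (bin (2 ℕ.+ m) 2)))
  SF-3+m-2 (suc n) zero    =
    trans (SF-3-s (suc n) 2) (sym (trans (ℤₚ.+-identityˡ (+ 1 * B₄)) (ℤₚ.*-identityˡ B₄)))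
    where B₄ = binomPred (suc n) 4
  SF-3+m-2 (suc n) (suc m) =
    trans (SF-prefix n (3 ℕ.+ m) (fib-bound ℕₚ.≤-refl (ℕₚ.m≤m+n 4 m)))
          (trans (cong₂ _+_ (SF-3+m-2 n m)
                            (cong₂ _+_ (cong₂ _+_ (SF-1+k-0 n (3 ℕ.+ m)) (SF-2+m-1 n (2 ℕ.+ m))) (SF-3+m-2 n (suc m))))
                 (coeff₂-step (+ m) (bin (2 ℕ.+ m) 2) (bin (3 ℕ.+ m) 2) (bin-suc-2 (2 ℕ.+ m))
                              (binomPred-pascal n (3 ℕ.+ m)) (binomPred-pascal n (4 ℕ.+ m))))

  SF-4+m-3 : ∀ n m → SF n (4 ℕ.+ m) 3 ≡ + m * binomPred n (4 ℕ.+ m)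
                                       + (bin (3 ℕ.+ m) 2 + bin (2 ℕ.+ m) 2 - + 1) * binomPred n (5 ℕ.+ m)
                                       + bin (4 ℕ.+ m) 3 * binomPred n (6 ℕ.+ m)
  SF-4+m-3 zero    m       =
    trans (SF-above-diagonal (s≤s z≤n) 3)
          (sym (vanishes₃ (+ m) (bin (3 ℕ.+ m) 2 + bin (2 ℕ.+ m) 2 - + 1) (bin (4 ℕ.+ m) 3)))
  SF-4+m-3 (suc n) zero    =
    trans (SF-window n 3 2 1 refl)
          (trans (cong₂ _+_ (SF-3-s n 3) (cong₂ _+_ (cong₂ _+_ (SF-2+m-1 n 2) (SF-3+m-2 n 1)) (SF-4+m-3 n 0)))
                 (coeff₃-base (binomPred n 3) (binomPred n 4) (binomPred n 5) (binomPred n 6)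
                              (binomPred-pascal n 3) (binomPred-pascal n 4) (binomPred-pascal n 5)))
  SF-4+m-3 (suc n) (suc m) =
    trans (SF-prefix n (4 ℕ.+ m) (fib-bound (ℕₚ.n≤1+n 4) (ℕₚ.m≤m+n 5 m)))
          (trans (cong₂ _+_ (SF-4+m-3 n m)
                            (cong₂ _+_ (cong₂ _+_ (cong₂ _+_ (SF-1+k-0 n (4 ℕ.+ m)) (SF-2+m-1 n (3 ℕ.+ m)))
                                                  (SF-3+m-2 n (2 ℕ.+ m)))
                                       (SF-4+m-3 n (suc m))))
                 (coeff₃-step (+ m) (bin (2 ℕ.+ m) 2) (bin (3 ℕ.+ m) 2) (bin (4 ℕ.+ m) 2) (bin (4 ℕ.+ m) 3) (bin (5 ℕ.+ m) 3)
                              (bin-suc-2 (2 ℕ.+ m)) (bin-suc-2 (3 ℕ.+ m)) (bin-pascal (4 ℕ.+ m) 2)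
                              (binomPred-pascal n (4 ℕ.+ m)) (binomPred-pascal n (5 ℕ.+ m))
                              (binomPred-pascal n (6 ℕ.+ m))))

  SF-4+m-4 : ∀ n m → SF n (4 ℕ.+ m) 4 ≡ + m * binomPred n (4 ℕ.+ m)
                                       + (bin (3 ℕ.+ m) 2 + bin (2 ℕ.+ m) 2 + bin (1 ℕ.+ m) 2 - + 3) * binomPred n (5 ℕ.+ m)
                                       + (+ 2 * bin (4 ℕ.+ m) 3 + bin (3 ℕ.+ m) 3 - + (4 ℕ.+ m) + + 1) * binomPred n (6 ℕ.+ m)
                                       + bin (5 ℕ.+ m) 4 * binomPred n (7 ℕ.+ m)
  SF-4+m-4 zero    m       =
    trans (SF-above-diagonal (s≤s z≤n) 4)
          (sym (vanishes₄ (+ m) (bin (3 ℕ.+ m) 2 + bin (2 ℕ.+ m) 2 + bin (1 ℕ.+ m) 2 - + 3)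
                                (+ 2 * bin (4 ℕ.+ m) 3 + bin (3 ℕ.+ m) 3 - + (4 ℕ.+ m) + + 1)
                                (bin (5 ℕ.+ m) 4)))
  SF-4+m-4 (suc n) zero    =
    trans (SF-window n 3 2 2 refl)
          (trans (cong₂ _+_ (SF-3-s n 4) (cong₂ _+_ (cong₂ _+_ (SF-3+m-2 n 1) (SF-4+m-3 n 0)) (SF-4+m-4 n 0)))
                 (coeff₄-base (binomPred n 3) (binomPred n 4) (binomPred n 5) (binomPred n 6) (binomPred n 7)
                              (binomPred-pascal n 3) (binomPred-pascal n 4)
                              (binomPred-pascal n 5) (binomPred-pascal n 6)))
  SF-4+m-4 (suc n) (suc m) =
    trans (SF-prefix n (4 ℕ.+ m) (fib-bound ℕₚ.≤-refl (ℕₚ.m≤m+n 5 m)))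
          (trans (cong₂ _+_ (SF-4+m-4 n m)
                            (cong₂ _+_ (cong₂ _+_ (cong₂ _+_ (cong₂ _+_ (SF-1+k-0 n (4 ℕ.+ m)) (SF-2+m-1 n (3 ℕ.+ m)))
                                                             (SF-3+m-2 n (2 ℕ.+ m)))
                                                  (SF-4+m-3 n (suc m)))
                                       (SF-4+m-4 n (suc m))))
                 (coeff₄-step (+ m) (bin (1 ℕ.+ m) 2) (bin (2 ℕ.+ m) 2) (bin (3 ℕ.+ m) 2) (bin (4 ℕ.+ m) 2)
                              (bin (3 ℕ.+ m) 3) (bin (4 ℕ.+ m) 3) (bin (5 ℕ.+ m) 3) (bin (5 ℕ.+ m) 4) (bin (6 ℕ.+ m) 4)
                              (bin-suc-2 (1 ℕ.+ m)) (bin-suc-2 (2 ℕ.+ m)) (bin-suc-2 (3 ℕ.+ m))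
                              (bin-pascal (3 ℕ.+ m) 2) (bin-pascal (4 ℕ.+ m) 2) (bin-pascal (5 ℕ.+ m) 3)
                              (binomPred-pascal n (4 ℕ.+ m)) (binomPred-pascal n (5 ℕ.+ m))
                              (binomPred-pascal n (6 ℕ.+ m)) (binomPred-pascal n (7 ℕ.+ m))))

  SF-coeff₀ : ∀ n k → 1 ≤ k → SF n k 0 ≡ binomPred n (k ∸ 1)
  SF-coeff₀ n (suc k) (s≤s _) = SF-1+k-0 n k

  SF-coeff₁ : ∀ n k → 2 ≤ k → SF n k 1 ≡ (+ k - + 2) * binomPred n k
  SF-coeff₁ n (suc (suc m)) (s≤s (s≤s _)) = SF-2+m-1 n m

  SF-column₃ : ∀ s n → SF n 3 s ≡ binomPred n (s ℕ.+ 2)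
  SF-column₃ s n = trans (SF-3-s n s) (cong (binomPred n) (ℕₚ.+-comm 2 s))

  SF-coeff₂ : ∀ n k → 3 ≤ k →
              SF n k 2 ≡ (+ k - + 3) * binomPred n k + bin (k ∸ 1) 2 * binomPred n (k ℕ.+ 1)
  SF-coeff₂ n (suc (suc (suc m))) (s≤s (s≤s (s≤s _))) rewrite ℕₚ.+-comm m 1 = SF-3+m-2 n m

  SF-coeff₃ : ∀ n k → 4 ≤ k →
              SF n k 3 ≡ (+ k - + 4) * binomPred n k
                         + (bin (k ∸ 1) 2 + bin (k ∸ 2) 2 - + 1) * binomPred n (k ℕ.+ 1)
                         + bin k 3 * binomPred n (k ℕ.+ 2)
  SF-coeff₃ n (suc (suc (suc (suc m)))) (s≤s (s≤s (s≤s (s≤s _)))) rewrite ℕₚ.+-comm m 1 | ℕₚ.+-comm m 2 = SF-4+m-3 n m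

  SF-coeff₄ : ∀ n k → 4 ≤ k →
              SF n k 4 ≡ (+ k - + 4) * binomPred n k
                         + (bin (k ∸ 1) 2 + bin (k ∸ 2) 2 + bin (k ∸ 3) 2 - + 3) * binomPred n (k ℕ.+ 1)
                         + (+ 2 * bin k 3 + bin (k ∸ 1) 3 - + k + + 1) * binomPred n (k ℕ.+ 2)
                         + bin (k ℕ.+ 1) 4 * binomPred n (k ℕ.+ 3)
  SF-coeff₄ n (suc (suc (suc (suc m)))) (s≤s (s≤s (s≤s (s≤s _)))) rewrite ℕₚ.+-comm m 1 | ℕₚ.+-comm m 2 | ℕₚ.+-comm m 3 = SF-4+m-4 n m

theorem12 : (SF : ℕ → ℕ → Series) → IsSF SF →
    ((n k : ℕ) → 1 ≤ k → k ≤ n → SF n k 0 ≡ binomPred n (k Data.Nat.∸ 1))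
    × ((n k : ℕ) → 2 ≤ k → k < n → SF n k 1 ≡ (+ k - + 2) * binomPred n k)
    × ((s n : ℕ) → s ≤ n → SF n 3 s ≡ binomPred n (s Data.Nat.+ 2))
    × ((n k : ℕ) → 3 ≤ k → k ≤ n →
         SF n k 2 ≡ (+ k - + 3) * binomPred n k
                    + bin (k Data.Nat.∸ 1) 2 * binomPred n (k Data.Nat.+ 1))
    × ((n k : ℕ) → 4 ≤ k → k ≤ n →
         SF n k 3 ≡ (+ k - + 4) * binomPred n k
                    + (bin (k Data.Nat.∸ 1) 2 + bin (k Data.Nat.∸ 2) 2 - + 1) * binomPred n (k Data.Nat.+ 1)
                    + bin k 3 * binomPred n (k Data.Nat.+ 2))
    × ((n k : ℕ) → 4 ≤ k → k ≤ n →
         SF n k 4 ≡ (+ k - + 4) * binomPred n k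
                    + (bin (k Data.Nat.∸ 1) 2 + bin (k Data.Nat.∸ 2) 2 + bin (k Data.Nat.∸ 3) 2 - + 3) * binomPred n (k Data.Nat.+ 1)
                    + (+ 2 * bin k 3 + bin (k Data.Nat.∸ 1) 3 - + k + + 1) * binomPred n (k Data.Nat.+ 2)
                    + bin (k Data.Nat.+ 1) 4 * binomPred n (k Data.Nat.+ 3))
theorem12 SF isSF =
    (λ n k 1≤k _ → SF-coeff₀ n k 1≤k)
  , (λ n k 2≤k _ → SF-coeff₁ n k 2≤k)
  , (λ s n _ → SF-column₃ s n)
  , (λ n k 3≤k _ → SF-coeff₂ n k 3≤k)
  , (λ n k 4≤k _ → SF-coeff₃ n k 4≤k)
  , (λ n k 4≤k _ → SF-coeff₄ n k 4≤k)
  where open Expansion SF isSF
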